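{- For the game $CSG(\{1,2,4\})$ and every integer $k\ge 0$, $\mathcal{G}(S_{1,1,1,k})$ equals $1$ if $k\equiv 0\pmod 3$, $0$ if $k\equiv 1\pmod 3$, and $3$ if $k\equiv 2\pmod 3$.
   Context: For a set $L$ of positive integers, the game $CSG(L)$ on a connected graph $G$ is the two-player impartial game in which a move consists in removing from the current graph a connected subgraph $H$ such that $|V(H)|\in L$ and the remaining graph is connected (the empty graph counts as connected, so removing the whole graph is allowed when its size is in $L$). The player unable to move loses. $\mathcal{G}(G)$ is the Grundy value of $CSG(\{1,2,4\})$ on $G$. The subdivided star $S_{\ell_1,\ldots,\ell_t}$ is obtained from a central vertex by attaching $t$ disjoint paths with $\ell_1,\ldots,\ell_t$ vertices (paths with $0$ vertices allowed). -}

module Defs where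

open import Data.Nat using (ℕ; zero; suc; _+_; _<_)
open import Data.Fin using (Fin; toℕ)
open import Data.Fin.Subset using (Subset; _∈_; _⊆_; _─_; ∣_∣; ⊤)
open import Data.List using (List; []; _∷_; _++_)
open import Data.Nat.ListAction using (sum)
open import Data.List.Membership.Propositional using () renaming (_∈_ to _∈ₗ_)
open import Data.Product using (_×_; _,_; ∃)
open import Data.Sum using (_⊎_)
open import Relation.Binary.PropositionalEquality using (_≡_; _≢_)

record Graph : Set₁ where
  field
    n   : ℕ
    Adj : Fin n → Fin n → Set
open Graph public

-- Vertex sets of the current position are subsets of V(G); the current
-- graph is the induced subgraph on such a subset.
-- Reachability inside U (paths using only vertices of U).
data Reach (G : Graph) (U : Subset (n G)) (x : Fin (n G)) : Fin (n G) → Set where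
  here : x ∈ U → Reach G U x x
  step : ∀ {y z} → Reach G U x y → Adj G y z → z ∈ U → Reach G U x z

-- The induced subgraph G[U] is connected (the empty graph counts as connected).
Connected : (G : Graph) → Subset (n G) → Set
Connected G U = ∀ x y → x ∈ U → y ∈ U → Reach G U x y

Move : (L : ℕ → Set) (G : Graph) → Subset (n G) → Subset (n G) → Set
Move L G U S = S ⊆ U × L ∣ S ∣ × Connected G S × Connected G (U ─ S)

-- HasGrundy L G U g : the Grundy value of CSG(L) at position G[U] is g,
-- i.e. g = mex { Grundy values of the options }.
data HasGrundy (L : ℕ → Set) (G : Graph) : Subset (n G) → ℕ → Set where
  grundy : ∀ {U g}
    → (∀ S → Move L G U S → ∃ λ h → HasGrundy L G (U ─ S) h × h ≢ g)
    → (∀ h → h < g → ∃ λ S → Move L G U S × HasGrundy L G (U ─ S) h)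
    → HasGrundy L G U g

GrundyIs : (L : ℕ → Set) (G : Graph) → ℕ → Set
GrundyIs L G g = HasGrundy L G ⊤ g

L124 : ℕ → Set
L124 m = m ≡ 1 ⊎ m ≡ 2 ⊎ m ≡ 4

-- Subdivided star S_{ℓ₁,…,ℓₜ}: centre is vertex 0; the arms occupy
-- consecutive blocks of vertices 1..ℓ₁, ℓ₁+1..ℓ₁+ℓ₂, …
-- armEdges prev o l: path of l new vertices o+1,…,o+l, the first attached to prev.
armEdges : ℕ → ℕ → ℕ → List (ℕ × ℕ)
armEdges prev o zero    = []
armEdges prev o (suc l) = (prev , suc o) ∷ armEdges (suc o) (suc o) l

starEdges : ℕ → List ℕ → List (ℕ × ℕ)
starEdges o []       = []
starEdges o (l ∷ ls) = armEdges 0 o l ++ starEdges (o + l) ls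

SubdividedStar : List ℕ → Graph
SubdividedStar ls = record
  { n   = suc (sum ls)
  ; Adj = λ a b → ((toℕ a , toℕ b) ∈ₗ starEdges 0 ls) ⊎ ((toℕ b , toℕ a) ∈ₗ starEdges 0 ls)
  }

-- Number the vertices of S₁,₁,₁,ₖ so that 0 is the centre, 1, 2, 3 are the short arms and
-- 4, 5, … the long arm; every edge joins some y > 0 to its parent, which is 0 if y ≤ 4 and
-- y − 1 otherwise.  Call a position (a connected vertex set U) full if it contains 0, …, 4.
-- By strong induction on |U|, the Grundy value of U is |U| mod 3 if U is not full, and 3, 1, 0
-- for |U| ≡ 0, 1, 2 if U is full.  A move removes 1, 2 or 4 ≢ 0 (mod 3) vertices, so it changes
-- |U| mod 3; the only possible clash, a pair move from a full position of size ≡ 2 to a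
-- non-full one of size ≡ 0 (both of value 0), cannot happen: such a pair must contain vertex 4
-- and leaves exactly the claw {0, 1, 2, 3}.  The options required by the mex are obtained by
-- deleting the leaf 1, the largest vertex (always a leaf of U), or the two largest vertices.
-- The whole star has 4 + k vertices and is full as soon as k ≥ 1.

module Submission where

open import Defs
open import Data.Nat using (ℕ; zero; suc; _+_; _<_; _≤_; _%_; z≤n; s≤s; _<?_; _≤?_)
open import Data.Nat.Properties
open import Data.Nat.Induction using (<-wellFounded)
open import Data.Nat.DivMod using ([m+n]%n≡m%n)
open import Data.Fin using (Fin; toℕ; fromℕ<) renaming (zero to fz; suc to fs)
open import Data.Fin.Properties
  using (toℕ-injective; toℕ-fromℕ<; toℕ<n; any?; all?) renaming (_≟_ to _≟ᶠ_)
open import Data.Fin.Subset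
open import Data.Fin.Subset.Properties
open import Data.List using (_∷_; [])
open import Data.List.Membership.Propositional using () renaming (_∈_ to _∈ₗ_)
open import Data.List.Membership.Propositional.Properties using (∈-++⁺ˡ; ∈-++⁻)
open import Data.List.Relation.Unary.Any using (here; there)
open import Data.Product using (_×_; _,_; ∃; proj₁; proj₂)
open import Data.Sum using (_⊎_; inj₁; inj₂; swap)
open import Data.Vec using ([]; _∷_; here; there)
open import Function using (_∘_)
open import Induction.WellFounded using (Acc; acc)
open import Relation.Binary.Definitions using (Symmetric)
open import Relation.Nullary using (¬_; yes; no; Dec; ¬?; contradiction)
open import Relation.Nullary.Decidable using (_×-dec_; _→-dec_; decidable-stable)
open import Relation.Binary.PropositionalEquality

-- Residues modulo 3

data Residue : Set where
  0₃ 1₃ 2₃ : Residue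

suc₃ pred₃ : Residue → Residue
suc₃ 0₃ = 1₃
suc₃ 1₃ = 2₃
suc₃ 2₃ = 0₃
pred₃ 0₃ = 2₃
pred₃ 1₃ = 0₃
pred₃ 2₃ = 1₃

residue : ℕ → Residue
residue zero    = 0₃
residue (suc n) = suc₃ (residue n)

suc₃³ : ∀ r → suc₃ (suc₃ (suc₃ r)) ≡ r
suc₃³ 0₃ = refl
suc₃³ 1₃ = refl
suc₃³ 2₃ = refl

pred₃-suc₃ : ∀ r → pred₃ (suc₃ r) ≡ r
pred₃-suc₃ 0₃ = refl
pred₃-suc₃ 1₃ = refl
pred₃-suc₃ 2₃ = refl

residue-pred : ∀ {r} v → residue (suc v) ≡ r → residue v ≡ pred₃ r
residue-pred v refl = sym (pred₃-suc₃ (residue v))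

residue≡2₃⇒2≤ : ∀ {n} → residue n ≡ 2₃ → 2 ≤ n
residue≡2₃⇒2≤ {suc (suc _)} _ = s≤s (s≤s z≤n)

residue≡2₃⇒≡2 : ∀ {n} → residue n ≡ 2₃ → n ≤ 4 → n ≡ 2
residue≡2₃⇒≡2 {2} _ _ = refl
residue≡2₃⇒≡2 {suc (suc (suc (suc (suc _))))} _ (s≤s (s≤s (s≤s (s≤s ()))))

pathValue fullValue : Residue → ℕ
pathValue 0₃ = 0
pathValue 1₃ = 1
pathValue 2₃ = 2
fullValue 0₃ = 3
fullValue 1₃ = 1
fullValue 2₃ = 0

pathValue-residue : ∀ n → pathValue (residue n) ≡ n % 3
pathValue-residue 0 = refl
pathValue-residue 1 = refl
pathValue-residue 2 = refl
pathValue-residue (suc (suc (suc n))) = begin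
  pathValue (suc₃ (suc₃ (suc₃ (residue n)))) ≡⟨ cong pathValue (suc₃³ (residue n)) ⟩
  pathValue (residue n)                       ≡⟨ pathValue-residue n ⟩
  n % 3                                       ≡⟨ [m+n]%n≡m%n n 3 ⟨
  (n + 3) % 3                                 ≡⟨ cong (_% 3) (+-comm n 3) ⟩
  (3 + n) % 3                                 ∎
  where open ≡-Reasoning

residue-pathValue : ∀ r → residue (pathValue r) ≡ r
residue-pathValue 0₃ = refl
residue-pathValue 1₃ = refl
residue-pathValue 2₃ = refl

residue-from-% : ∀ {n r} → n % 3 ≡ pathValue r → residue n ≡ r
residue-from-% {n} {r} n%3≡ = begin
  residue n                       ≡⟨ residue-pathValue (residue n) ⟨
  residue (pathValue (residue n)) ≡⟨ cong residue (trans (pathValue-residue n) n%3≡) ⟩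
  residue (pathValue r)           ≡⟨ residue-pathValue r ⟩
  r                               ∎
  where open ≡-Reasoning

pathValue-moves : ∀ {s} → L124 s → ∀ v → pathValue (residue v) ≢ pathValue (residue (s + v))
pathValue-moves (inj₁ refl) v with residue v
... | 0₃ = λ ()
... | 1₃ = λ ()
... | 2₃ = λ ()
pathValue-moves (inj₂ (inj₁ refl)) v with residue v
... | 0₃ = λ ()
... | 1₃ = λ ()
... | 2₃ = λ ()
pathValue-moves (inj₂ (inj₂ refl)) v with residue v
... | 0₃ = λ ()
... | 1₃ = λ ()
... | 2₃ = λ ()

fullValue-moves : ∀ {s} → L124 s → ∀ v → fullValue (residue v) ≢ fullValue (residue (s + v))
fullValue-moves (inj₁ refl) v with residue v
... | 0₃ = λ ()
... | 1₃ = λ ()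
... | 2₃ = λ ()
fullValue-moves (inj₂ (inj₁ refl)) v with residue v
... | 0₃ = λ ()
... | 1₃ = λ ()
... | 2₃ = λ ()
fullValue-moves (inj₂ (inj₂ refl)) v with residue v
... | 0₃ = λ ()
... | 1₃ = λ ()
... | 2₃ = λ ()

pathValue≡fullValue-moves : ∀ {s} → L124 s → ∀ v
  → pathValue (residue v) ≡ fullValue (residue (s + v)) → s ≡ 2 × residue v ≡ 0₃
pathValue≡fullValue-moves (inj₁ refl) v with residue v
... | 0₃ = λ ()
... | 1₃ = λ ()
... | 2₃ = λ ()
pathValue≡fullValue-moves (inj₂ (inj₁ refl)) v with residue v
... | 0₃ = λ _ → refl , refl
... | 1₃ = λ ()
... | 2₃ = λ ()
pathValue≡fullValue-moves (inj₂ (inj₂ refl)) v with residue v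
... | 0₃ = λ ()
... | 1₃ = λ ()
... | 2₃ = λ ()

-- Subsets of Fin n

x∈p─q⇒x∉q : ∀ {n} {x : Fin n} {p q : Subset n} → x ∈ p ─ q → x ∉ q
x∈p─q⇒x∉q {p = inside ∷ _} {outside ∷ _} here = λ ()
x∈p─q⇒x∉q {p = _ ∷ _} {_ ∷ _} (there x∈) (there x∈q) = x∈p─q⇒x∉q x∈ x∈q

∣p∣≡∣q∣+∣p─q∣ : ∀ {n} {p q : Subset n} → q ⊆ p → ∣ p ∣ ≡ ∣ q ∣ + ∣ p ─ q ∣
∣p∣≡∣q∣+∣p─q∣ {p = []} {[]} _ = refl
∣p∣≡∣q∣+∣p─q∣ {p = outside ∷ p} {outside ∷ q} q⊆p = ∣p∣≡∣q∣+∣p─q∣ (drop-∷-⊆ q⊆p)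
∣p∣≡∣q∣+∣p─q∣ {p = inside ∷ p} {outside ∷ q} q⊆p =
  trans (cong suc (∣p∣≡∣q∣+∣p─q∣ (drop-∷-⊆ q⊆p))) (sym (+-suc ∣ q ∣ ∣ p ─ q ∣))
∣p∣≡∣q∣+∣p─q∣ {p = inside ∷ p} {inside ∷ q} q⊆p = cong suc (∣p∣≡∣q∣+∣p─q∣ (drop-∷-⊆ q⊆p))
∣p∣≡∣q∣+∣p─q∣ {p = outside ∷ p} {inside ∷ q} q⊆p with q⊆p here
... | ()

⁅x⁆⊆p : ∀ {n} {x : Fin n} {p : Subset n} → x ∈ p → ⁅ x ⁆ ⊆ p
⁅x⁆⊆p {x = x} {p} x∈ y∈ = subst (_∈ p) (sym (x∈⁅y⁆⇒x≡y x y∈)) x∈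

∣⁅x⁆∪⁅y⁆∣≡2 : ∀ {n} {x y : Fin n} → x ≢ y → ∣ ⁅ x ⁆ ∪ ⁅ y ⁆ ∣ ≡ 2
∣⁅x⁆∪⁅y⁆∣≡2 {x = fz}   {fz}   x≢y = contradiction refl x≢y
∣⁅x⁆∪⁅y⁆∣≡2 {x = fz}   {fs y} _   = cong suc (trans (cong ∣_∣ (∪-identityˡ ⁅ y ⁆)) (∣⁅x⁆∣≡1 y))
∣⁅x⁆∪⁅y⁆∣≡2 {x = fs x} {fz}   _   = cong suc (trans (cong ∣_∣ (∪-identityʳ ⁅ x ⁆)) (∣⁅x⁆∣≡1 x))
∣⁅x⁆∪⁅y⁆∣≡2 {x = fs x} {fs y} x≢y = ∣⁅x⁆∪⁅y⁆∣≡2 (x≢y ∘ cong fs)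

∃-other : ∀ {n} (p : Subset n) (x : Fin n) → 2 ≤ ∣ p ∣ → ∃ λ y → y ∈ p × y ≢ x
∃-other p x 2≤∣p∣ with any? (λ y → (y ∈? p) ×-dec ¬? (y ≟ᶠ x))
... | yes found = found
... | no none = contradiction (subst (∣ p ∣ ≤_) (∣⁅x⁆∣≡1 x) (p⊆q⇒∣p∣≤∣q∣ p⊆⁅x⁆)) (<⇒≱ 2≤∣p∣)
  where
  p⊆⁅x⁆ : p ⊆ ⁅ x ⁆
  p⊆⁅x⁆ {y} y∈ =
    subst (_∈ ⁅ x ⁆) (sym (decidable-stable (y ≟ᶠ x) (λ y≢x → none (y , y∈ , y≢x)))) (x∈⁅x⁆ x)

Bounded : ∀ {n} → ℕ → Subset n → Set
Bounded c p = ∀ {x} → x ∈ p → toℕ x < c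

Initial : ∀ {n} → ℕ → Subset n → Set
Initial c p = ∀ x → toℕ x < c → x ∈ p

bounded⇒∣p∣≤ : ∀ {n} {p : Subset n} c → Bounded c p → ∣ p ∣ ≤ c
bounded⇒∣p∣≤ {p = []} _ _ = z≤n
bounded⇒∣p∣≤ {p = outside ∷ _} c b = bounded⇒∣p∣≤ c (λ x∈ → <-trans (n<1+n _) (b (there x∈)))
bounded⇒∣p∣≤ {p = inside ∷ _} zero b = contradiction (b here) n≮0
bounded⇒∣p∣≤ {p = inside ∷ _} (suc c) b = s≤s (bounded⇒∣p∣≤ c (λ x∈ → ≤-pred (b (there x∈))))

initial⇒≤∣p∣ : ∀ {n} {p : Subset n} c → c ≤ n → Initial c p → c ≤ ∣ p ∣
initial⇒≤∣p∣ zero _ _ = z≤n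
initial⇒≤∣p∣ {p = inside ∷ _} (suc c) (s≤s c≤n) i =
  s≤s (initial⇒≤∣p∣ c c≤n (λ x x<c → drop-there (i (fs x) (s≤s x<c))))
initial⇒≤∣p∣ {p = outside ∷ _} (suc c) _ i with i fz (s≤s z≤n)
... | ()

bounded⇒initial : ∀ {n} {p : Subset n} c → Bounded c p → c ≤ ∣ p ∣ → Initial c p
bounded⇒initial {p = inside ∷ _} (suc c) _ _ fz _ = here
bounded⇒initial {p = inside ∷ _} (suc c) b (s≤s c≤) (fs x) (s≤s x<c) =
  there (bounded⇒initial c (λ y∈ → ≤-pred (b (there y∈))) c≤ x x<c)
bounded⇒initial {p = outside ∷ _} (suc c) b c< _ _ =
  contradiction (bounded⇒∣p∣≤ c (λ y∈ → ≤-pred (b (there y∈)))) (<⇒≱ c<)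

initial-suc : ∀ {n} {p : Subset n} {c z} → Initial c p → z ∈ p → toℕ z ≡ c → Initial (suc c) p
initial-suc {p = p} i z∈ refl x x<1+z with m<1+n⇒m<n∨m≡n x<1+z
... | inj₁ x<z = i x x<z
... | inj₂ x≡z = subst (_∈ p) (toℕ-injective (sym x≡z)) z∈

IsMax : ∀ {n} → Subset n → Fin n → Set
IsMax p m = m ∈ p × Bounded (suc (toℕ m)) p

maximum : ∀ {n} (p : Subset n) → Nonempty p → ∃ (IsMax p)
maximum (_ ∷ p) _ with nonempty? p
maximum (_ ∷ p) _ | yes p≠∅ with maximum p p≠∅
... | m , m∈ , m-bound =
  fs m , there m∈ , λ { {fz} _ → s≤s z≤n ; {fs y} y∈ → s≤s (m-bound (drop-there y∈)) }
maximum (_ ∷ p) (fz , x∈) | no p=∅ =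
  fz , x∈ , λ { {fz} _ → s≤s z≤n ; {fs y} y∈ → contradiction (y , drop-there y∈) p=∅ }
maximum (_ ∷ p) (fs y , y∈) | no p=∅ = contradiction (y , drop-there y∈) p=∅

bounded-max : ∀ {n} {p : Subset n} {m c} → IsMax p m → toℕ m < c → Bounded c p
bounded-max (_ , m-bound) m<c y∈ = <-≤-trans (m-bound y∈) m<c

0<∣p∣⇒nonempty : ∀ {n} (p : Subset n) → 0 < ∣ p ∣ → Nonempty p
0<∣p∣⇒nonempty p 0<∣p∣ with nonempty? p
... | yes p≠∅ = p≠∅
... | no p=∅ = contradiction (bounded⇒∣p∣≤ 0 (λ x∈ → contradiction (_ , x∈) p=∅)) (<⇒≱ 0<∣p∣)

residue-after : ∀ {n} {U S : Subset n} {s r} → S ⊆ U → ∣ S ∣ ≡ s → residue ∣ U ∣ ≡ r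
  → residue (s + ∣ U ─ S ∣) ≡ r
residue-after S⊆U refl r≡ = trans (cong residue (sym (∣p∣≡∣q∣+∣p─q∣ S⊆U))) r≡

residue-─⁅x⁆ : ∀ {n} {U : Subset n} {x r} → x ∈ U → residue ∣ U ∣ ≡ r → residue ∣ U - x ∣ ≡ pred₃ r
residue-─⁅x⁆ {U = U} {x} x∈ r≡ =
  residue-pred ∣ U - x ∣ (residue-after (⁅x⁆⊆p x∈) (∣⁅x⁆∣≡1 x) r≡)

residue-─pair : ∀ {n} {U S : Subset n} {r} → S ⊆ U → ∣ S ∣ ≡ 2 → residue ∣ U ∣ ≡ r
  → residue ∣ U ─ S ∣ ≡ pred₃ (pred₃ r)
residue-─pair {U = U} {S} S⊆U ∣S∣≡2 r≡ =
  residue-pred ∣ U ─ S ∣ (residue-pred (suc ∣ U ─ S ∣) (residue-after S⊆U ∣S∣≡2 r≡))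

-- Walks and connectivity

module _ {G : Graph} where

  reach-end : ∀ {U x y} → Reach G U x y → y ∈ U
  reach-end (here y∈) = y∈
  reach-end (step _ _ y∈) = y∈

  reach-trans : ∀ {U x y z} → Reach G U x y → Reach G U y z → Reach G U x z
  reach-trans r (here _) = r
  reach-trans r (step r′ a z∈) = step (reach-trans r r′) a z∈

  reach-sym : Symmetric (Adj G) → ∀ {U x y} → Reach G U x y → Reach G U y x
  reach-sym _ (here x∈) = here x∈
  reach-sym adj-sym (step r a z∈) =
    reach-trans (step (here z∈) (adj-sym a) (reach-end r)) (reach-sym adj-sym r)

  connected-from : Symmetric (Adj G) → ∀ {U r} → (∀ {y} → y ∈ U → Reach G U r y) → Connected G U
  connected-from adj-sym reach x y x∈ y∈ = reach-trans (reach-sym adj-sym (reach x∈)) (reach y∈)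

  reach-by-descent : ∀ {U r} → r ∈ U
    → (∀ {y} → y ∈ U → y ≢ r → ∃ λ x → x ∈ U × toℕ x < toℕ y × Adj G x y)
    → ∀ {y} → y ∈ U → Reach G U r y
  reach-by-descent {U} {r} r∈ descend {y} y∈ = go y∈ (<-wellFounded (toℕ y))
    where
    go : ∀ {y} → y ∈ U → Acc _<_ (toℕ y) → Reach G U r y
    go {y} y∈ (acc rs) with y ≟ᶠ r
    ... | yes refl = here r∈
    ... | no y≢r = let x , x∈ , x<y , x~y = descend y∈ y≢r in step (go x∈ (rs x<y)) x~y y∈

  Leaf : Subset (n G) → Fin (n G) → Set
  Leaf U ℓ = ∀ {z z′} → z ∈ U → z′ ∈ U → Adj G ℓ z → Adj G ℓ z′ → z ≡ z′

  connected-─-leaf : Symmetric (Adj G) → ∀ {U ℓ} → Leaf U ℓ → Connected G U → Connected G (U - ℓ)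
  connected-─-leaf adj-sym {U} {ℓ} leaf cU x y x∈ y∈ =
    proj₁ (reroute (cU x y (p─q⊆p U ⁅ ℓ ⁆ x∈) (p─q⊆p U ⁅ ℓ ⁆ y∈)) (≢ℓ x∈)) (≢ℓ y∈)
    where
    ≢ℓ : ∀ {x} → x ∈ U - ℓ → x ≢ ℓ
    ≢ℓ = x∉⁅y⁆⇒x≢y ∘ x∈p─q⇒x∉q
    -- A walk enters and leaves ℓ only through ℓ's unique neighbour in U, so cutting out
    -- its visits to ℓ keeps it inside U - ℓ.
    reroute : ∀ {x y} → Reach G U x y → x ≢ ℓ
      → (y ≢ ℓ → Reach G (U - ℓ) x y)
      × (y ≡ ℓ → ∃ λ z → z ∈ U × Adj G ℓ z × Reach G (U - ℓ) x z)
    reroute (here x∈) x≢ℓ = (λ _ → here (x∈p∧x≢y⇒x∈p-y x∈ x≢ℓ)) , (λ x≡ℓ → contradiction x≡ℓ x≢ℓ)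
    reroute (step {y} {z} r y~z z∈) x≢ℓ with reroute r x≢ℓ | y ≟ᶠ ℓ | z ≟ᶠ ℓ
    ... | avoid , _ | no y≢ℓ | no z≢ℓ =
      (λ _ → step (avoid y≢ℓ) y~z (x∈p∧x≢y⇒x∈p-y z∈ z≢ℓ)) , (λ z≡ℓ → contradiction z≡ℓ z≢ℓ)
    ... | _ , enter | yes refl | no z≢ℓ =
      (λ _ → let w , w∈ , ℓ~w , r′ = enter refl
             in subst (Reach G (U - ℓ) _) (leaf w∈ z∈ ℓ~w y~z) r′) ,
      (λ z≡ℓ → contradiction z≡ℓ z≢ℓ)
    ... | avoid , _ | no y≢ℓ | yes refl =
      (λ ℓ≢ℓ → contradiction refl ℓ≢ℓ) , (λ _ → y , reach-end r , adj-sym y~z , avoid y≢ℓ)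
    ... | _ , enter | yes refl | yes refl = (λ ℓ≢ℓ → contradiction refl ℓ≢ℓ) , enter

  connected⇒neighbour : ∀ {U x} → Connected G U → x ∈ U → 2 ≤ ∣ U ∣ → ∃ λ y → y ∈ U × Adj G y x
  connected⇒neighbour {U} {x} cU x∈ 2≤∣U∣ with ∃-other U x 2≤∣U∣
  ... | w , w∈ , w≢x with cU w x w∈ x∈
  ...   | here _ = contradiction refl w≢x
  ...   | step r y~x _ = _ , reach-end r , y~x

  connected-⁅x⁆ : ∀ x → Connected G ⁅ x ⁆
  connected-⁅x⁆ x y z y∈ z∈ with x∈⁅y⁆⇒x≡y x y∈ | x∈⁅y⁆⇒x≡y x z∈
  ... | refl | refl = here y∈

  leaf-move : ∀ {L} → Symmetric (Adj G) → L 1 → ∀ {U ℓ} → Connected G U → ℓ ∈ U → Leaf U ℓ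
    → Move L G U ⁅ ℓ ⁆
  leaf-move {L} adj-sym L1 {ℓ = ℓ} cU ℓ∈ leaf =
    ⁅x⁆⊆p ℓ∈ , subst L (sym (∣⁅x⁆∣≡1 ℓ)) L1 , connected-⁅x⁆ ℓ , connected-─-leaf adj-sym leaf cU

  pair-move : ∀ {L} → Symmetric (Adj G) → L 2 → ∀ {U m p} → m ∈ U → p ∈ U → Adj G p m → p ≢ m
    → Connected G (U - m - p) → Move L G U (⁅ m ⁆ ∪ ⁅ p ⁆)
  pair-move {L} adj-sym L2 {U} {m} {p} m∈ p∈ p~m p≢m cV =
    S⊆U , subst L (sym (∣⁅x⁆∪⁅y⁆∣≡2 (p≢m ∘ sym))) L2 , cS ,
    subst (Connected G) (p─q─r≡p─q∪r U ⁅ m ⁆ ⁅ p ⁆) cV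
    where
    S = ⁅ m ⁆ ∪ ⁅ p ⁆
    m∈S : m ∈ S
    m∈S = x∈p∪q⁺ (inj₁ (x∈⁅x⁆ m))
    p∈S : p ∈ S
    p∈S = x∈p∪q⁺ (inj₂ (x∈⁅x⁆ p))
    ∈S : ∀ {x} → x ∈ S → x ≡ m ⊎ x ≡ p
    ∈S x∈ with x∈p∪q⁻ ⁅ m ⁆ ⁅ p ⁆ x∈
    ... | inj₁ x∈⁅m⁆ = inj₁ (x∈⁅y⁆⇒x≡y m x∈⁅m⁆)
    ... | inj₂ x∈⁅p⁆ = inj₂ (x∈⁅y⁆⇒x≡y p x∈⁅p⁆)
    S⊆U : S ⊆ U
    S⊆U x∈ with ∈S x∈
    ... | inj₁ refl = m∈
    ... | inj₂ refl = p∈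
    cS : Connected G S
    cS x y x∈ y∈ with ∈S x∈ | ∈S y∈
    ... | inj₁ refl | inj₁ refl = here m∈S
    ... | inj₂ refl | inj₂ refl = here p∈S
    ... | inj₂ refl | inj₁ refl = step (here p∈S) p~m m∈S
    ... | inj₁ refl | inj₂ refl = step (here m∈S) (adj-sym p~m) p∈S

  whole-move : ∀ {L U} → L ∣ U ∣ → Connected G U → Move L G U U
  whole-move {U = U} L∣U∣ cU =
    (λ x∈ → x∈) , L∣U∣ , cU , λ _ _ x∈ _ → contradiction (p─q⊆p U U x∈) (x∈p─q⇒x∉q x∈)

-- Grundy values

module _ {L : ℕ → Set} {G : Graph} (L-positive : ∀ {s} → L s → 0 < s)
  (value : Subset (n G) → ℕ)
  (value-changes : ∀ {U S} → Connected G U → Move L G U S → value (U ─ S) ≢ value U)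
  (value-reachable : ∀ {U h} → Connected G U → h < value U
    → ∃ λ S → Move L G U S × value (U ─ S) ≡ h)
  where

  hasGrundy-value : ∀ {U} → Connected G U → HasGrundy L G U (value U)
  hasGrundy-value {U} = go (<-wellFounded ∣ U ∣)
    where
    shrinks : ∀ {U S} → Move L G U S → ∣ U ─ S ∣ < ∣ U ∣
    shrinks {U} {S} (S⊆U , L∣S∣ , _) =
      subst (∣ U ─ S ∣ <_) (sym (∣p∣≡∣q∣+∣p─q∣ S⊆U)) (m<n+m ∣ U ─ S ∣ (L-positive L∣S∣))
    go : ∀ {U} → Acc _<_ ∣ U ∣ → Connected G U → HasGrundy L G U (value U)
    go {U} (acc rs) cU = grundy
      (λ S mv@(_ , _ , _ , cV) → value (U ─ S) , go (rs (shrinks mv)) cV , value-changes cU mv)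
      (λ h h< → let S , mv@(_ , _ , _ , cV) , value≡h = value-reachable cU h<
                in S , mv , subst (HasGrundy L G (U ─ S)) value≡h (go (rs (shrinks mv)) cV))

-- The subdivided star S₁,₁,₁,ₖ

parent : ℕ → ℕ
parent (suc (suc (suc (suc (suc m))))) = suc (suc (suc (suc m)))
parent _ = 0

parent-≤4 : ∀ {y} → y ≤ 4 → parent y ≡ 0
parent-≤4 {0} _ = refl
parent-≤4 {1} _ = refl
parent-≤4 {2} _ = refl
parent-≤4 {3} _ = refl
parent-≤4 {4} _ = refl
parent-≤4 {suc (suc (suc (suc (suc _))))} (s≤s (s≤s (s≤s (s≤s ()))))

parent-≥5 : ∀ {y} → 5 ≤ y → suc (parent y) ≡ y
parent-≥5 (s≤s (s≤s (s≤s (s≤s (s≤s _))))) = refl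

parent-< : ∀ {y} → 0 < y → parent y < y
parent-< {y} 0<y with y ≤? 4
... | yes y≤4 = subst (_< y) (sym (parent-≤4 y≤4)) 0<y
... | no y≰4 = subst (parent y <_) (parent-≥5 (≰⇒> y≰4)) (n<1+n (parent y))

parent<4⇒≤4 : ∀ {y} → parent y < 4 → y ≤ 4
parent<4⇒≤4 {y} p<4 with y ≤? 4
... | yes y≤4 = y≤4
... | no y≰4 = contradiction (subst (5 ≤_) (sym (parent-≥5 (≰⇒> y≰4))) (≰⇒> y≰4)) (<⇒≱ (s≤s p<4))

IsParent : ℕ → ℕ → Set
IsParent x y = 0 < y × x ≡ parent y

armEdges⁻ : ∀ {x y} p o l → (x , y) ∈ₗ armEdges p o l → (x ≡ p × y ≡ suc o) ⊎ (suc o ≤ x × y ≡ suc x)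
armEdges⁻ p o (suc l) (here refl) = inj₁ (refl , refl)
armEdges⁻ p o (suc l) (there e) with armEdges⁻ (suc o) (suc o) l e
... | inj₁ (refl , refl) = inj₂ (≤-refl , refl)
... | inj₂ (o<x , refl) = inj₂ (<⇒≤ o<x , refl)

armEdges-first : ∀ p o l → 0 < l → (p , suc o) ∈ₗ armEdges p o l
armEdges-first p o (suc l) _ = here refl

armEdges-next : ∀ p o l i → 2 + i ≤ l → (suc (i + o) , suc (suc (i + o))) ∈ₗ armEdges p o l
armEdges-next p o (suc (suc l)) zero _ = there (here refl)
armEdges-next p o (suc l) (suc i) (s≤s 2+i≤l) =
  there (subst (λ t → (suc t , suc (suc t)) ∈ₗ armEdges (suc o) (suc o) l) (+-suc i o)
               (armEdges-next (suc o) (suc o) l i 2+i≤l))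

starEdges⁻ : ∀ k {x y} → (x , y) ∈ₗ starEdges 0 (1 ∷ 1 ∷ 1 ∷ k ∷ []) → IsParent x y
starEdges⁻ k (here refl) = s≤s z≤n , refl
starEdges⁻ k (there (here refl)) = s≤s z≤n , refl
starEdges⁻ k (there (there (here refl))) = s≤s z≤n , refl
starEdges⁻ k (there (there (there e))) with ∈-++⁻ (armEdges 0 3 k) e
... | inj₂ ()
... | inj₁ e′ with armEdges⁻ 0 3 k e′
...   | inj₁ (refl , refl) = s≤s z≤n , refl
...   | inj₂ (4≤x , refl) = s≤s z≤n , suc-injective (sym (parent-≥5 (s≤s 4≤x)))

starEdges⁺ : ∀ k y → 0 < y → y < n (SubdividedStar (1 ∷ 1 ∷ 1 ∷ k ∷ []))
  → (parent y , y) ∈ₗ starEdges 0 (1 ∷ 1 ∷ 1 ∷ k ∷ [])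
starEdges⁺ k 1 _ _ = here refl
starEdges⁺ k 2 _ _ = there (here refl)
starEdges⁺ k 3 _ _ = there (there (here refl))
starEdges⁺ k 4 _ (s≤s (s≤s (s≤s (s≤s 1≤k+0)))) =
  there (there (there (∈-++⁺ˡ (armEdges-first 0 3 k (subst (0 <_) (+-identityʳ k) 1≤k+0)))))
starEdges⁺ k (suc (suc (suc (suc (suc i))))) _ (s≤s (s≤s (s≤s (s≤s 2+i≤k+0)))) =
  there (there (there (∈-++⁺ˡ (subst (λ t → (suc t , suc (suc t)) ∈ₗ armEdges 0 3 k) (+-comm i 3)
    (armEdges-next 0 3 k i (subst (2 + i ≤_) (+-identityʳ k) 2+i≤k+0))))))

L124-positive : ∀ {s} → L124 s → 0 < s
L124-positive (inj₁ refl) = s≤s z≤n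
L124-positive (inj₂ (inj₁ refl)) = s≤s z≤n
L124-positive (inj₂ (inj₂ refl)) = s≤s z≤n

module Star (k : ℕ) where

  G : Graph
  G = SubdividedStar (1 ∷ 1 ∷ 1 ∷ k ∷ [])

  N : ℕ
  N = n G

  v0 v1 v2 v3 : Fin N
  v0 = fz
  v1 = fs fz
  v2 = fs (fs fz)
  v3 = fs (fs (fs fz))

  data ShortArm : Fin N → Set where
    arm₁ : ShortArm v1
    arm₂ : ShortArm v2
    arm₃ : ShortArm v3

  short-arm-bounds : ∀ {i} → ShortArm i → 0 < toℕ i × toℕ i < 4
  short-arm-bounds arm₁ = s≤s z≤n , s≤s (s≤s z≤n)
  short-arm-bounds arm₂ = s≤s z≤n , s≤s (s≤s (s≤s z≤n))
  short-arm-bounds arm₃ = s≤s z≤n , s≤s (s≤s (s≤s (s≤s z≤n)))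

  initial-4 : ∀ {W : Subset N} → v0 ∈ W → v1 ∈ W → v2 ∈ W → v3 ∈ W → Initial 4 W
  initial-4 v0∈ _ _ _ fz _ = v0∈
  initial-4 _ v1∈ _ _ (fs fz) _ = v1∈
  initial-4 _ _ v2∈ _ (fs (fs fz)) _ = v2∈
  initial-4 _ _ _ v3∈ (fs (fs (fs fz))) _ = v3∈
  initial-4 _ _ _ _ (fs (fs (fs (fs _)))) (s≤s (s≤s (s≤s (s≤s ()))))

  adj-sym : Symmetric (Adj G)
  adj-sym = swap

  adj⇒parent : ∀ {a b} → Adj G a b → IsParent (toℕ a) (toℕ b) ⊎ IsParent (toℕ b) (toℕ a)
  adj⇒parent (inj₁ e) = inj₁ (starEdges⁻ k e)
  adj⇒parent (inj₂ e) = inj₂ (starEdges⁻ k e)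

  adj-irrefl : ∀ {a} → ¬ Adj G a a
  adj-irrefl a~a with adj⇒parent a~a
  ... | inj₁ (0<a , a≡) = <-irrefl (sym a≡) (parent-< 0<a)
  ... | inj₂ (0<a , a≡) = <-irrefl (sym a≡) (parent-< 0<a)

  adj-from-above : ∀ {a b} → Adj G a b → toℕ b < toℕ a → toℕ b ≡ parent (toℕ a)
  adj-from-above a~b b<a with adj⇒parent a~b
  ... | inj₁ (0<b , a≡) = contradiction (subst (_< _) (sym a≡) (parent-< 0<b)) (<-asym b<a)
  ... | inj₂ (_ , b≡) = b≡

  adj-below-4 : ∀ {a b} → toℕ a < 4 → Adj G a b → toℕ b ≤ 4
  adj-below-4 a<4 a~b with adj⇒parent a~b
  ... | inj₁ (_ , a≡) = parent<4⇒≤4 (subst (_< 4) a≡ a<4)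
  ... | inj₂ (_ , b≡) = subst (_≤ 4) (sym (trans b≡ (parent-≤4 (<⇒≤ a<4)))) z≤n

  short-arm-adj : ∀ {i z} → ShortArm i → Adj G i z → z ≡ v0
  short-arm-adj arm i~z with short-arm-bounds arm | adj⇒parent i~z
  ... | 0<i , i<4 | inj₁ (_ , i≡) =
    contradiction (trans i≡ (parent-≤4 (parent<4⇒≤4 (subst (_< 4) i≡ i<4)))) (≢-sym (<⇒≢ 0<i))
  ... | _ , i<4 | inj₂ (_ , z≡) = toℕ-injective (trans z≡ (parent-≤4 (<⇒≤ i<4)))

  arm-needs-centre : ∀ {W i} → Connected G W → 2 ≤ ∣ W ∣ → ShortArm i → i ∈ W → v0 ∈ W
  arm-needs-centre {W} cW 2≤∣W∣ arm i∈ with connected⇒neighbour cW i∈ 2≤∣W∣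
  ... | y , y∈ , y~i = subst (_∈ W) (short-arm-adj arm (adj-sym y~i)) y∈

  reach-avoiding-4 : ∀ {W y} → (∀ {z} → z ∈ W → toℕ z ≢ 4) → Reach G W v0 y → toℕ y < 4
  reach-avoiding-4 _ (here _) = s≤s z≤n
  reach-avoiding-4 no-4 (step r a z∈) = ≤∧≢⇒< (adj-below-4 (reach-avoiding-4 no-4 r) a) (no-4 z∈)

  max-neighbour : ∀ {U m z} → IsMax U m → z ∈ U → Adj G m z → toℕ z ≡ parent (toℕ m)
  max-neighbour (_ , m-bound) z∈ m~z = adj-from-above m~z
    (≤∧≢⇒< (≤-pred (m-bound z∈)) (λ z≡m → adj-irrefl (subst (Adj G _) (toℕ-injective z≡m) m~z)))

  max-leaf : ∀ {U m} → IsMax U m → Leaf {G = G} U m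
  max-leaf m-max z∈ z′∈ m~z m~z′ =
    toℕ-injective (trans (max-neighbour m-max z∈ m~z) (sym (max-neighbour m-max z′∈ m~z′)))

  short-arm-leaf : ∀ {U i} → ShortArm i → Leaf {G = G} U i
  short-arm-leaf arm _ _ i~z i~z′ = trans (short-arm-adj arm i~z) (sym (short-arm-adj arm i~z′))

  -- The conjunct 5 ≤ N makes the claw S₁,₁,₁,₀ itself non-full.
  Full : Subset N → Set
  Full U = 5 ≤ N × Initial 5 U

  full? : ∀ U → Dec (Full U)
  full? U = 5 ≤? N ×-dec all? (λ x → toℕ x <? 5 →-dec x ∈? U)

  value : Subset N → ℕ
  value U with full? U
  ... | yes _ = fullValue (residue ∣ U ∣)
  ... | no _ = pathValue (residue ∣ U ∣)

  value-full : ∀ {U} → Full U → value U ≡ fullValue (residue ∣ U ∣)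
  value-full {U} fU with full? U
  ... | yes _ = refl
  ... | no ¬fU = contradiction fU ¬fU

  value-nonFull : ∀ {U} → ¬ Full U → value U ≡ pathValue (residue ∣ U ∣)
  value-nonFull {U} ¬fU with full? U
  ... | yes fU = contradiction fU ¬fU
  ... | no _ = refl

  value-1₃ : ∀ {U} → residue ∣ U ∣ ≡ 1₃ → value U ≡ 1
  value-1₃ {U} r≡ with full? U
  ... | yes _ = cong fullValue r≡
  ... | no _ = cong pathValue r≡

  full⇒5≤∣U∣ : ∀ {U} → Full U → 5 ≤ ∣ U ∣
  full⇒5≤∣U∣ (5≤N , U-initial) = initial⇒≤∣p∣ 5 5≤N U-initial

  nonFull-─ : ∀ {U S} → ¬ Full U → ¬ Full (U ─ S)
  nonFull-─ {U} {S} ¬fU (5≤N , V-initial) = ¬fU (5≤N , λ x x<5 → p─q⊆p U S (V-initial x x<5))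

  nonFull-─v1 : ∀ {U} → ¬ Full (U - v1)
  nonFull-─v1 (_ , V-initial) = x∈p─q⇒x∉q (V-initial v1 (s≤s (s≤s z≤n))) (x∈⁅x⁆ v1)

  full-─-max : ∀ {U m} → Full U → 5 ≤ toℕ m → Full (U - m)
  full-─-max (5≤N , U-initial) 5≤m =
    5≤N , λ x x<5 → x∈p∧x≢y⇒x∈p-y (U-initial x x<5) (λ { refl → <⇒≱ x<5 5≤m })

  nonFull-bounded : ∀ {U} → ¬ Full U → Bounded 5 U → ∣ U ∣ ≤ 4
  nonFull-bounded {U} ¬fU U-bounded with 5 ≤? ∣ U ∣
  ... | yes 5≤∣U∣ = contradiction (≤-trans 5≤∣U∣ (∣p∣≤n U) , bounded⇒initial 5 U-bounded 5≤∣U∣) ¬fU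
  ... | no ∣U∣≱5 = ≤-pred (≰⇒> ∣U∣≱5)

  -- If the largest vertex is below 5, then U = {0, …, 4}, whose size has residue 2₃.
  full-large-max : ∀ {U m} → Full U → IsMax U m → residue ∣ U ∣ ≡ 0₃ → 5 ≤ toℕ m
  full-large-max {U} {m} fU m-max r≡ with 5 ≤? toℕ m
  ... | yes 5≤m = 5≤m
  ... | no m≱5 = contradiction (trans (sym r≡) (cong residue ∣U∣≡5)) λ ()
    where
    ∣U∣≡5 : ∣ U ∣ ≡ 5
    ∣U∣≡5 = ≤-antisym (bounded⇒∣p∣≤ 5 (bounded-max m-max (≰⇒> m≱5))) (full⇒5≤∣U∣ fU)

  pair-avoids-claw : ∀ {U S} → Full U → S ⊆ U → Connected G S → ∣ S ∣ ≡ 2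
    → Connected G (U ─ S) → 2 ≤ ∣ U ─ S ∣ → Initial 4 (U ─ S)
  pair-avoids-claw {U} {S} (_ , U-initial) S⊆U cS ∣S∣≡2 cV 2≤∣V∣ =
    initial-4 (in-V (s≤s z≤n) v0∉S) (in-V (arm<5 arm₁) (arm∉S arm₁))
              (in-V (arm<5 arm₂) (arm∉S arm₂)) (in-V (arm<5 arm₃) (arm∉S arm₃))
    where
    in-V : ∀ {x} → toℕ x < 5 → x ∉ S → x ∈ U ─ S
    in-V {x} x<5 = x∈p∧x∉q⇒x∈p─q (U-initial x x<5)
    arm<5 : ∀ {i} → ShortArm i → toℕ i < 5
    arm<5 arm = m<n⇒m<1+n (proj₂ (short-arm-bounds arm))
    -- An arm outside S stays in U ─ S, which then has to contain the centre as well.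
    arm∈S : v0 ∈ S → ∀ {i} → ShortArm i → i ∈ S
    arm∈S v0∈S {i} arm = decidable-stable (i ∈? S) λ i∉S →
      x∈p─q⇒x∉q (arm-needs-centre cV 2≤∣V∣ arm (x∈p∧x∉q⇒x∈p─q (U-initial i (arm<5 arm)) i∉S)) v0∈S
    v0∉S : v0 ∉ S
    v0∉S v0∈S = <⇒≱ (s≤s (s≤s (s≤s z≤n))) (subst (4 ≤_) ∣S∣≡2
      (initial⇒≤∣p∣ 4 (s≤s (s≤s (s≤s (s≤s z≤n))))
        (initial-4 v0∈S (arm∈S v0∈S arm₁) (arm∈S v0∈S arm₂) (arm∈S v0∈S arm₃))))
    arm∉S : ∀ {i} → ShortArm i → i ∉ S
    arm∉S arm i∈S = v0∉S (arm-needs-centre cS (≤-reflexive (sym ∣S∣≡2)) arm i∈S)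

  remove-short-arm : ∀ {U i} → Connected G U → ShortArm i → i ∈ U → Move L124 G U ⁅ i ⁆
  remove-short-arm cU arm i∈ = leaf-move {L = L124} adj-sym (inj₁ refl) cU i∈ (short-arm-leaf arm)

  remove-max : ∀ {U m} → Connected G U → IsMax U m → Move L124 G U ⁅ m ⁆
  remove-max cU m-max = leaf-move {L = L124} adj-sym (inj₁ refl) cU (proj₁ m-max) (max-leaf m-max)

  -- For m ≥ 5 the parent p of m is m − 1, hence the largest vertex of U - m.
  remove-top-pair : ∀ {U m} → Connected G U → IsMax U m → 5 ≤ toℕ m → 2 ≤ ∣ U ∣
    → ∃ λ S → Move L124 G U S × ∣ S ∣ ≡ 2
  remove-top-pair {U} {m} cU m-max@(m∈ , m-bound) 5≤m 2≤∣U∣ with connected⇒neighbour cU m∈ 2≤∣U∣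
  ... | p , p∈ , p~m =
    ⁅ m ⁆ ∪ ⁅ p ⁆ ,
    pair-move {L = L124} adj-sym (inj₂ (inj₁ refl)) m∈ p∈ p~m p≢m
      (connected-─-leaf adj-sym (max-leaf p-max) (connected-─-leaf adj-sym (max-leaf m-max) cU)) ,
    ∣⁅x⁆∪⁅y⁆∣≡2 (p≢m ∘ sym)
    where
    p≢m : p ≢ m
    p≢m p≡m = adj-irrefl (subst (λ y → Adj G y m) p≡m p~m)
    m≡1+p : toℕ m ≡ suc (toℕ p)
    m≡1+p = trans (sym (parent-≥5 5≤m)) (cong suc (sym (max-neighbour m-max p∈ (adj-sym p~m))))
    p-max : IsMax (U - m) p
    p-max = x∈p∧x≢y⇒x∈p-y p∈ p≢m , λ {y} y∈ → subst (toℕ y <_) m≡1+p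
      (≤∧≢⇒< (≤-pred (m-bound (p─q⊆p U ⁅ m ⁆ y∈))) (x∉⁅y⁆⇒x≢y (x∈p─q⇒x∉q y∈) ∘ toℕ-injective))

  remove-pair-nonFull : ∀ {U} → Connected G U → ¬ Full U → residue ∣ U ∣ ≡ 2₃
    → ∃ λ S → Move L124 G U S × ∣ S ∣ ≡ 2
  remove-pair-nonFull {U} cU ¬fU r≡
    with maximum U (0<∣p∣⇒nonempty U (≤-trans (s≤s z≤n) (residue≡2₃⇒2≤ r≡)))
  ... | m , m-max with 5 ≤? toℕ m
  ...   | yes 5≤m = remove-top-pair cU m-max 5≤m (residue≡2₃⇒2≤ r≡)
  ...   | no m≱5 = U , whole-move {L = L124} (inj₂ (inj₁ ∣U∣≡2)) cU , ∣U∣≡2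
    where
    ∣U∣≡2 : ∣ U ∣ ≡ 2
    ∣U∣≡2 = residue≡2₃⇒≡2 r≡ (nonFull-bounded ¬fU (bounded-max m-max (≰⇒> m≱5)))

  pair-to-nonFull-leaves-claw : ∀ {U S} → Full U → Move L124 G U S → ∣ S ∣ ≡ 2 → ¬ Full (U ─ S)
    → ∣ U ─ S ∣ ≡ 4
  pair-to-nonFull-leaves-claw {U} {S} fU@(5≤N , _) (S⊆U , _ , cS , cV) ∣S∣≡2 ¬fV =
    ≤-antisym (bounded⇒∣p∣≤ 4 V-bounded) (initial⇒≤∣p∣ 4 (s≤s (s≤s (s≤s (s≤s z≤n)))) V-initial)
    where
    3≤∣V∣ : 3 ≤ ∣ U ─ S ∣
    3≤∣V∣ = ≤-pred (≤-pred (subst (5 ≤_) (trans (∣p∣≡∣q∣+∣p─q∣ S⊆U) (cong (_+ ∣ U ─ S ∣) ∣S∣≡2))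
      (full⇒5≤∣U∣ fU)))
    V-initial : Initial 4 (U ─ S)
    V-initial = pair-avoids-claw fU S⊆U cS ∣S∣≡2 cV (≤-trans (n≤1+n 2) 3≤∣V∣)
    no-4 : ∀ {z} → z ∈ U ─ S → toℕ z ≢ 4
    no-4 z∈ z≡4 = ¬fV (5≤N , initial-suc V-initial z∈ z≡4)
    V-bounded : Bounded 4 (U ─ S)
    V-bounded y∈ = reach-avoiding-4 no-4 (cV v0 _ (V-initial v0 (s≤s z≤n)) y∈)

  value-changes : ∀ {U S} → Connected G U → Move L124 G U S → value (U ─ S) ≢ value U
  value-changes {U} {S} _ mv@(S⊆U , s∈L , _) with full? U | full? (U ─ S)
  ... | yes _ | yes _ rewrite ∣p∣≡∣q∣+∣p─q∣ S⊆U =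
    fullValue-moves s∈L ∣ U ─ S ∣
  ... | no _ | no _ rewrite ∣p∣≡∣q∣+∣p─q∣ S⊆U =
    pathValue-moves s∈L ∣ U ─ S ∣
  ... | no ¬fU | yes fV = contradiction fV (nonFull-─ ¬fU)
  ... | yes fU | no ¬fV rewrite ∣p∣≡∣q∣+∣p─q∣ S⊆U = λ values≡ →
    let ∣S∣≡2 , r≡0₃ = pathValue≡fullValue-moves s∈L ∣ U ─ S ∣ values≡
        ∣V∣≡4 = pair-to-nonFull-leaves-claw fU mv ∣S∣≡2 ¬fV
    in contradiction (trans (cong residue (sym ∣V∣≡4)) r≡0₃) λ ()

  OptionValue : Subset N → ℕ → Set
  OptionValue U h = ∃ λ S → Move L124 G U S × value (U ─ S) ≡ h

  short-arm-option : ∀ {U r} → Connected G U → Full U → residue ∣ U ∣ ≡ r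
    → OptionValue U (pathValue (pred₃ r))
  short-arm-option cU (_ , U-initial) r≡ =
    ⁅ v1 ⁆ , remove-short-arm cU arm₁ v1∈ ,
    trans (value-nonFull nonFull-─v1) (cong pathValue (residue-─⁅x⁆ v1∈ r≡))
    where v1∈ = U-initial v1 (s≤s (s≤s z≤n))

  max-option-full : ∀ {U m r} → Connected G U → Full U → IsMax U m → 5 ≤ toℕ m → residue ∣ U ∣ ≡ r
    → OptionValue U (fullValue (pred₃ r))
  max-option-full {m = m} cU fU m-max 5≤m r≡ =
    ⁅ m ⁆ , remove-max cU m-max ,
    trans (value-full (full-─-max fU 5≤m)) (cong fullValue (residue-─⁅x⁆ (proj₁ m-max) r≡))

  max-option-nonFull : ∀ {U r} → Connected G U → ¬ Full U → r ≢ 0₃ → residue ∣ U ∣ ≡ r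
    → OptionValue U (pathValue (pred₃ r))
  max-option-nonFull {U} cU ¬fU r≢0₃ r≡
    with maximum U (0<∣p∣⇒nonempty U (n≢0⇒n>0 λ ∣U∣≡0 → r≢0₃ (trans (sym r≡) (cong residue ∣U∣≡0))))
  ... | m , m-max =
    ⁅ m ⁆ , remove-max cU m-max ,
    trans (value-nonFull (nonFull-─ ¬fU)) (cong pathValue (residue-─⁅x⁆ (proj₁ m-max) r≡))

  pair-option-full : ∀ {U m} → Connected G U → Full U → IsMax U m → 5 ≤ toℕ m → residue ∣ U ∣ ≡ 0₃
    → OptionValue U 1
  pair-option-full cU fU m-max 5≤m r≡ =
    let S , mv , ∣S∣≡2 = remove-top-pair cU m-max 5≤m (≤-trans (s≤s (s≤s z≤n)) (full⇒5≤∣U∣ fU))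
    in S , mv , value-1₃ (residue-─pair (proj₁ mv) ∣S∣≡2 r≡)

  pair-option-nonFull : ∀ {U} → Connected G U → ¬ Full U → residue ∣ U ∣ ≡ 2₃ → OptionValue U 0
  pair-option-nonFull cU ¬fU r≡ =
    let S , mv , ∣S∣≡2 = remove-pair-nonFull cU ¬fU r≡
    in S , mv ,
       trans (value-nonFull (nonFull-─ ¬fU)) (cong pathValue (residue-─pair (proj₁ mv) ∣S∣≡2 r≡))

  value-reachable : ∀ {U h} → Connected G U → h < value U → OptionValue U h
  value-reachable {U} cU h< with full? U
  value-reachable {U} cU h< | yes fU@(_ , U-initial)
    with residue ∣ U ∣ in r≡ | h< | maximum U (v0 , U-initial v0 (s≤s z≤n))
  ... | 0₃ | s≤s z≤n | _ , m-max = max-option-full cU fU m-max (full-large-max fU m-max r≡) r≡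
  ... | 0₃ | s≤s (s≤s z≤n) | _ , m-max = pair-option-full cU fU m-max (full-large-max fU m-max r≡) r≡
  ... | 0₃ | s≤s (s≤s (s≤s z≤n)) | _ = short-arm-option cU fU r≡
  ... | 1₃ | s≤s z≤n | _ = short-arm-option cU fU r≡
  value-reachable {U} cU h< | no ¬fU with residue ∣ U ∣ in r≡ | h<
  ... | 1₃ | s≤s z≤n = max-option-nonFull cU ¬fU (λ ()) r≡
  ... | 2₃ | s≤s z≤n = pair-option-nonFull cU ¬fU r≡
  ... | 2₃ | s≤s (s≤s z≤n) = max-option-nonFull cU ¬fU (λ ()) r≡

  parent-vertex : ∀ {y} → y ∈ ⊤ → y ≢ v0 → ∃ λ x → x ∈ ⊤ × toℕ x < toℕ y × Adj G x y
  parent-vertex {fz} _ y≢v0 = contradiction refl y≢v0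
  parent-vertex {y@(fs _)} _ _ =
    x , ∈⊤ , subst (_< toℕ y) (sym x≡) parent<y ,
    inj₁ (subst (λ t → (t , toℕ y) ∈ₗ starEdges 0 (1 ∷ 1 ∷ 1 ∷ k ∷ [])) (sym x≡)
                (starEdges⁺ k (toℕ y) (s≤s z≤n) (toℕ<n y)))
    where
    parent<y = parent-< (s≤s z≤n)
    x = fromℕ< (<-trans parent<y (toℕ<n y))
    x≡ = toℕ-fromℕ< (<-trans parent<y (toℕ<n y))

  connected-⊤ : Connected G ⊤
  connected-⊤ = connected-from adj-sym (reach-by-descent ∈⊤ parent-vertex)

  grundy-⊤ : GrundyIs L124 G (value ⊤)
  grundy-⊤ = hasGrundy-value L124-positive value value-changes value-reachable connected-⊤

  residue-⊤ : residue ∣ ⊤ {N} ∣ ≡ suc₃ (residue k)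
  residue-⊤ = begin
    residue ∣ ⊤ {N} ∣                            ≡⟨ cong residue (∣⊤∣≡n N) ⟩
    suc₃ (suc₃ (suc₃ (suc₃ (residue (k + 0))))) ≡⟨ suc₃³ _ ⟩
    suc₃ (residue (k + 0))                       ≡⟨ cong (suc₃ ∘ residue) (+-identityʳ k) ⟩
    suc₃ (residue k)                             ∎
    where open ≡-Reasoning

-- For k = 0 the star is the claw, which is not full; its size 4 has residue 1₃, where the two
-- value tables agree.
value-⊤ : ∀ k → Star.value k ⊤ ≡ fullValue (suc₃ (residue k))
value-⊤ zero = Star.value-1₃ 0 {⊤} (Star.residue-⊤ 0)
value-⊤ (suc k) =
  trans (Star.value-full (suc k) (s≤s (s≤s (s≤s (s≤s (s≤s z≤n)))) , λ _ _ → ∈⊤))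
        (cong fullValue (Star.residue-⊤ (suc k)))

lemma22 : (k : ℕ)
    → (k % 3 ≡ 0 → GrundyIs L124 (SubdividedStar (1 ∷ 1 ∷ 1 ∷ k ∷ [])) 1)
    × (k % 3 ≡ 1 → GrundyIs L124 (SubdividedStar (1 ∷ 1 ∷ 1 ∷ k ∷ [])) 0)
    × (k % 3 ≡ 2 → GrundyIs L124 (SubdividedStar (1 ∷ 1 ∷ 1 ∷ k ∷ [])) 3)
lemma22 k = grundy-at 0₃ , grundy-at 1₃ , grundy-at 2₃
  where
  grundy-at : ∀ r → k % 3 ≡ pathValue r → GrundyIs L124 (Star.G k) (fullValue (suc₃ r))
  grundy-at r k%3≡ = subst (GrundyIs L124 (Star.G k))
    (trans (value-⊤ k) (cong (fullValue ∘ suc₃) (residue-from-% {k} k%3≡))) (Star.grundy-⊤ k)
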